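{- Let $G$ be a directed graph with two edge-disjoint factors $F$ and $F_0$. For each vertex $v$, let $s(v)$ and $s_0(v)$ be integers with $s(v)\le d_{F}(v)$ and $s_0(v)\le d_{F_0}(v)$, and let $L(v)\subseteq \{s(v),\ldots, d_G(v)-s_0(v)\}$. If for each vertex $v$, $$|L(v)| \ge d_{G}^+(v)+1+d^-_{F}(v)+d^-_{F_0}(v)-s(v)-s_0(v),$$ then $G$ has a factor $H$ containing all edges of $F$ and no edges of $F_0$ such that $d_H(v)\in L(v)$ for each vertex $v$.
   Context: Graphs may have loops and multiple edges. A factor is a spanning subgraph. $d_G(v)$ denotes the (total, undirected) degree of $v$, and $d^+(v)$, $d^-(v)$ denote out-degree and in-degree with respect to the orientation (for subgraphs, the induced orientation). -}

module Defs where

open import Data.Nat using (ℕ; _+_)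
open import Data.Bool using (Bool; true; false; _∧_; if_then_else_)
open import Data.Fin using (Fin; _≟_)
open import Data.List using (List; map; allFin)
open import Data.Nat.ListAction using (sum)
open import Relation.Nullary.Decidable using (⌊_⌋)

record Digraph : Set where
  field
    n    : ℕ
    m    : ℕ
    tail : Fin m → Fin n
    head : Fin m → Fin n

open Digraph public

-- A factor (spanning subgraph) is given by its edge set.
EdgeSet : Digraph → Set
EdgeSet G = Fin (m G) → Bool

allEdges : (G : Digraph) → EdgeSet G
allEdges G e = true

outdeg : (G : Digraph) → EdgeSet G → Fin (n G) → ℕ
outdeg G S v = sum (map (λ e → if S e ∧ ⌊ tail G e ≟ v ⌋ then 1 else 0) (allFin (m G)))

indeg : (G : Digraph) → EdgeSet G → Fin (n G) → ℕ
indeg G S v = sum (map (λ e → if S e ∧ ⌊ head G e ≟ v ⌋ then 1 else 0) (allFin (m G)))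

-- total undirected degree (a loop counts twice)
deg : (G : Digraph) → EdgeSet G → Fin (n G) → ℕ
deg G S v = outdeg G S v + indeg G S v

module Submission where

-- Call an edge free if it lies in neither F nor F₀, and charge it to its head. By the hypothesis
-- on |L(v)|, the integers of [s(v), d_G(v) − s₀(v)] missing from L(v) are at most as many as the
-- free edges entering v. Pair every missing value b with its own free edge into v and regard the
-- product of the factors d_H(v) − b as a function of the set of free edges added to F. Each factor
-- is affine in every edge variable, with slope the number of ends of that edge at v: nonnegative,
-- and positive at its own edge. So the mixed finite difference of the product over all free edges
-- is the permanent of this slope matrix, hence positive, and the product is nonzero at some H. At
-- that H each degree lies in [s(v), d_G(v) − s₀(v)] and avoids every missing value: it lies in L(v).

open import Data.Bool as Bool using (Bool; true; false; if_then_else_; _∧_)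
open import Data.Empty using (⊥-elim)
open import Data.Fin using (Fin; _≟_)
open import Data.Integer as ℤ using (ℤ; +_; _+_; _-_; -_; _*_; 0ℤ; 1ℤ; _≤_; ∣_∣)
import Data.Integer.Properties as ℤP
open import Data.Integer.Tactic.RingSolver using (solve-∀)
open import Data.List using (List; []; _∷_; _++_; [_]; map; length; filter; upTo; allFin; concat; replicate)
open import Data.List.Properties
  using ( length-++; length-map; length-upTo; length-replicate; length-removeAt′
        ; map-++; map-id; map-cong; map-cong-local)
open import Data.List.Membership.Propositional using (_∈_; _∉_; _─_)
open import Data.List.Membership.Propositional.Properties
  using (∈-allFin; ∈-filter⁺; ∈-filter⁻; ∈-lookup; ∈-map⁺; ∈-upTo⁺; ∈-++⁺ˡ; ∈-concat⁺′)
open import Data.List.Membership.DecPropositional ℤ._≟_ using (_∈?_)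
open import Data.List.Relation.Binary.Disjoint.Propositional using (Disjoint)
import Data.List.Relation.Binary.Pointwise as Pointwise
open import Data.List.Relation.Binary.Pointwise using (Pointwise; []; _∷_; Pointwise-length)
open import Data.List.Relation.Unary.All as All using (All; []; _∷_)
import Data.List.Relation.Unary.All.Properties as All
open import Data.List.Relation.Unary.AllPairs as AllPairs using (_∷_)
import Data.List.Relation.Unary.AllPairs.Properties as AllPairs
open import Data.List.Relation.Unary.Any using (here; there)
open import Data.List.Relation.Unary.Unique.Propositional using (Unique)
import Data.List.Relation.Unary.Unique.Propositional.Properties as Unique
open import Data.Nat as ℕ using (ℕ; suc; z≤n; s≤s; _∸_)
open import Data.Nat.ListAction using (sum)
import Data.Nat.Properties as ℕP
open import Algebra.Properties.CommutativeSemigroup ℕP.+-commutativeSemigroup using (interchange)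
open import Data.Product using (Σ; ∃-syntax; _×_; _,_; proj₁; proj₂)
open import Data.Vec using (Vec; lookup; tabulate; _[_]≔_)
open import Data.Vec.Properties using ([]≔-commutes; lookup∘update; lookup∘update′; lookup∘tabulate)
open import Function using (id; _∘_)
open import Relation.Binary.PropositionalEquality hiding ([_])
open import Relation.Nullary using (Dec; yes; no; ¬?; _×-dec_)
open import Relation.Nullary.Decidable using (⌊_⌋)
open import Relation.Unary using (Decidable)

open import Defs

indicator : Bool → ℕ
indicator b = if b then 1 else 0

indicator-∧-mono : ∀ {a b} c → (a ≡ true → b ≡ true) → indicator (a ∧ c) ℕ.≤ indicator (b ∧ c)
indicator-∧-mono {false}          c _   = z≤n
indicator-∧-mono {true}  {true}  c _   = ℕP.≤-refl
indicator-∧-mono {true}  {false} c a⇒b with () ← a⇒b refl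

indicator-∧-disjoint : ∀ {a b} c → (a ≡ true → b ≡ false) →
                       indicator (a ∧ c) ℕ.+ indicator (b ∧ c) ℕ.≤ indicator c
indicator-∧-disjoint {false} {false} c _   = z≤n
indicator-∧-disjoint {false} {true}  c _   = ℕP.≤-refl
indicator-∧-disjoint {true}  {false} c _   = ℕP.≤-reflexive (ℕP.+-identityʳ _)
indicator-∧-disjoint {true}  {true}  c a⇒¬b with () ← a⇒¬b refl

module _ {A : Set} where

  sum-map-+ : ∀ (f g : A → ℕ) xs → sum (map (λ x → f x ℕ.+ g x) xs) ≡ sum (map f xs) ℕ.+ sum (map g xs)
  sum-map-+ f g []       = refl
  sum-map-+ f g (x ∷ xs) =
    trans (cong (f x ℕ.+ g x ℕ.+_) (sum-map-+ f g xs)) (interchange (f x) (g x) _ _)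

  sum-map-mono : ∀ {f g : A → ℕ} → (∀ x → f x ℕ.≤ g x) → ∀ xs → sum (map f xs) ℕ.≤ sum (map g xs)
  sum-map-mono f≤g []       = z≤n
  sum-map-mono f≤g (x ∷ xs) = ℕP.+-mono-≤ (f≤g x) (sum-map-mono f≤g xs)

  sum-map-update : ∀ {x} {f g : A → ℕ} {xs} → Unique xs → x ∈ xs → (∀ {y} → y ≢ x → f y ≡ g y) →
                   sum (map f xs) ℕ.+ g x ≡ sum (map g xs) ℕ.+ f x
  sum-map-update {x} {f} {g} {x ∷ ys} (x∉ys ∷ _) (here refl) f≡g = begin
      f x ℕ.+ sum (map f ys) ℕ.+ g x   ≡⟨ ℕP.+-comm (f x ℕ.+ _) (g x) ⟩
      g x ℕ.+ (f x ℕ.+ sum (map f ys)) ≡⟨ cong (λ zs → g x ℕ.+ (f x ℕ.+ sum zs)) f≡g-on-ys ⟩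
      g x ℕ.+ (f x ℕ.+ sum (map g ys)) ≡⟨ cong (g x ℕ.+_) (ℕP.+-comm (f x) _) ⟩
      g x ℕ.+ (sum (map g ys) ℕ.+ f x) ≡⟨ ℕP.+-assoc (g x) _ (f x) ⟨
      g x ℕ.+ sum (map g ys) ℕ.+ f x   ∎
    where
    open ≡-Reasoning
    f≡g-on-ys : map f ys ≡ map g ys
    f≡g-on-ys = map-cong-local (All.map (λ x≢y → f≡g (x≢y ∘ sym)) x∉ys)
  sum-map-update {x} {f} {g} {y ∷ ys} (y∉ys ∷ ys-unique) (there x∈ys) f≡g = begin
      f y ℕ.+ sum (map f ys) ℕ.+ g x   ≡⟨ ℕP.+-assoc (f y) _ (g x) ⟩
      f y ℕ.+ (sum (map f ys) ℕ.+ g x) ≡⟨ cong₂ ℕ._+_ (f≡g y≢x) (sum-map-update ys-unique x∈ys f≡g) ⟩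
      g y ℕ.+ (sum (map g ys) ℕ.+ f x) ≡⟨ ℕP.+-assoc (g y) _ (f x) ⟨
      g y ℕ.+ sum (map g ys) ℕ.+ f x   ∎
    where
    open ≡-Reasoning
    y≢x = All.lookup y∉ys x∈ys

  module _ {P : A → Set} (P? : Decidable P) where

    sum-indicator≡length-filter : ∀ xs → sum (map (λ x → indicator ⌊ P? x ⌋) xs) ≡ length (filter P? xs)
    sum-indicator≡length-filter []       = refl
    sum-indicator≡length-filter (x ∷ xs) with P? x
    ... | yes _ = cong suc (sum-indicator≡length-filter xs)
    ... | no  _ = sum-indicator≡length-filter xs

    length-filter-¬+length-filter : ∀ xs → length (filter (¬? ∘ P?) xs) ℕ.+ length (filter P? xs) ≡ length xs
    length-filter-¬+length-filter []       = refl
    length-filter-¬+length-filter (x ∷ xs) with P? x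
    ... | yes _ = trans (ℕP.+-suc _ _) (cong suc (length-filter-¬+length-filter xs))
    ... | no  _ = cong suc (length-filter-¬+length-filter xs)

  ∈-─ : ∀ {x z : A} {ys} (x∈ys : x ∈ ys) → z ∈ ys → z ≢ x → z ∈ ys ─ x∈ys
  ∈-─ (here refl) (here refl)  z≢x = ⊥-elim (z≢x refl)
  ∈-─ (here refl) (there z∈ys) _   = z∈ys
  ∈-─ (there _)   (here refl)  _   = here refl
  ∈-─ (there x∈ys) (there z∈ys) z≢x = there (∈-─ x∈ys z∈ys z≢x)

  Unique-⊆⇒length≤ : ∀ {xs ys : List A} → Unique xs → (∀ {x} → x ∈ xs → x ∈ ys) → length xs ℕ.≤ length ys
  Unique-⊆⇒length≤ {[]}     _                  _     = z≤n
  Unique-⊆⇒length≤ {x ∷ xs} {ys} (x∉xs ∷ xs-unique) xs⊆ys =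
    ℕP.≤-trans (s≤s (Unique-⊆⇒length≤ xs-unique xs⊆ys─x))
               (ℕP.≤-reflexive (sym (length-removeAt′ ys _)))
    where
    x∈ys = xs⊆ys (here refl)
    xs⊆ys─x : ∀ {z} → z ∈ xs → z ∈ ys ─ x∈ys
    xs⊆ys─x z∈xs = ∈-─ x∈ys (xs⊆ys (there z∈xs)) (λ z≡x → All.lookup x∉xs z∈xs (sym z≡x))

range : ℤ → ℕ → List ℤ
range a k = map (λ i → a + + i) (upTo k)

length-range : ∀ a k → length (range a k) ≡ k
length-range a k = trans (length-map _ (upTo k)) (length-upTo k)

∈-range : ∀ {a b y} → a ≤ y → y ≤ b → y ∈ range a (suc ∣ b - a ∣)
∈-range {a} {b} {y} a≤y y≤b =
  subst (_∈ range a (suc ∣ b - a ∣)) a+[y-a]≡y (∈-map⁺ (λ i → a + + i) (∈-upTo⁺ (s≤s i≤j)))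
  where
  ∣-∣-nonneg : ∀ {c} → a ≤ c → + ∣ c - a ∣ ≡ c - a
  ∣-∣-nonneg a≤c = ℤP.0≤i⇒+∣i∣≡i (ℤP.i≤j⇒0≤j-i a≤c)
  i≤j : ∣ y - a ∣ ℕ.≤ ∣ b - a ∣
  i≤j = ℤP.drop‿+≤+ (subst₂ _≤_ (sym (∣-∣-nonneg a≤y)) (sym (∣-∣-nonneg (ℤP.≤-trans a≤y y≤b)))
                                 (ℤP.+-monoˡ-≤ (- a) y≤b))
  a+[y-a]≡y : a + + ∣ y - a ∣ ≡ y
  a+[y-a]≡y = trans (cong (_+_ a) (∣-∣-nonneg a≤y)) (solve a y)
    where
    solve : ∀ a y → a + (y - a) ≡ y
    solve = solve-∀

missing : List ℤ → ℤ → ℤ → List ℤ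
missing L a b = filter (λ y → ¬? (y ∈? L)) (range a (suc ∣ b - a ∣))

∈-missing : ∀ {L a b y} → a ≤ y → y ≤ b → y ∉ L → y ∈ missing L a b
∈-missing a≤y y≤b y∉L = ∈-filter⁺ (λ y → ¬? (y ∈? _)) (∈-range a≤y y≤b) y∉L

length-missing : ∀ {L a b} → Unique L → All (λ x → a ≤ x × x ≤ b) L →
                 length (missing L a b) ℕ.+ length L ℕ.≤ suc ∣ b - a ∣
length-missing {L} {a} {b} L-unique L⊆[a,b] = begin
  length (missing L a b) ℕ.+ length L             ≤⟨ ℕP.+-monoʳ-≤ _ (Unique-⊆⇒length≤ L-unique L⊆present) ⟩
  length (missing L a b) ℕ.+ length (filter (_∈? L) R) ≡⟨ length-filter-¬+length-filter (_∈? L) R ⟩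
  length R                                        ≡⟨ length-range a _ ⟩
  suc ∣ b - a ∣                                   ∎
  where
  open ℕP.≤-Reasoning
  R = range a (suc ∣ b - a ∣)
  L⊆present : ∀ {x} → x ∈ L → x ∈ filter (_∈? L) R
  L⊆present x∈L = let a≤x , x≤b = All.lookup L⊆[a,b] x∈L in ∈-filter⁺ (_∈? L) (∈-range a≤x x≤b) x∈L

-- Finite differences and permanents

-- Assignments are Boolean vectors rather than functions Fin m → Bool, so that updates at distinct
-- positions commute up to propositional equality, without function extensionality.
module _ {m : ℕ} where

  δ : Fin m → (Vec Bool m → ℤ) → Vec Bool m → ℤ
  δ x f H = f (H [ x ]≔ true) - f (H [ x ]≔ false)

  Δ : List (Fin m) → (Vec Bool m → ℤ) → Vec Bool m → ℤ
  Δ []       f = f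
  Δ (x ∷ xs) f = Δ xs (δ x f)

  Δ-cong : ∀ xs {f g} → f ≗ g → Δ xs f ≗ Δ xs g
  Δ-cong []       f≗g = f≗g
  Δ-cong (x ∷ xs) f≗g = Δ-cong xs (λ H → cong₂ _-_ (f≗g _) (f≗g _))

  Δ-+ : ∀ xs f g H → Δ xs (λ H → f H + g H) H ≡ Δ xs f H + Δ xs g H
  Δ-+ []       f g H = refl
  Δ-+ (x ∷ xs) f g H =
    trans (Δ-cong xs (λ H → sub-+ (f (H [ x ]≔ true)) (g (H [ x ]≔ true))
                                  (f (H [ x ]≔ false)) (g (H [ x ]≔ false))) H)
          (Δ-+ xs (δ x f) (δ x g) H)
    where
    sub-+ : ∀ a b c d → (a + b) - (c + d) ≡ (a - c) + (b - d)
    sub-+ = solve-∀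

  Δ-*ˡ : ∀ xs k f H → Δ xs (λ H → k * f H) H ≡ k * Δ xs f H
  Δ-*ˡ []       k f H = refl
  Δ-*ˡ (x ∷ xs) k f H =
    trans (Δ-cong xs (λ H → *-distribˡ-- k (f (H [ x ]≔ true)) (f (H [ x ]≔ false))) H)
          (Δ-*ˡ xs k (δ x f) H)
    where
    *-distribˡ-- : ∀ k a b → k * a - k * b ≡ k * (a - b)
    *-distribˡ-- = solve-∀

  Δ-0 : ∀ xs → Δ xs (λ _ → 0ℤ) ≗ (λ _ → 0ℤ)
  Δ-0 []       H = refl
  Δ-0 (x ∷ xs) H = Δ-0 xs H

  Δ≢0⇒∃≢0 : (P : Vec Bool m → Set) → ∀ xs f {H} →
            All (λ x → ∀ {H} b → P H → P (H [ x ]≔ b)) xs → P H →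
            Δ xs f H ≢ 0ℤ → ∃[ H′ ] P H′ × f H′ ≢ 0ℤ
  Δ≢0⇒∃≢0 P []       f _ PH Δ≢0 = _ , PH , Δ≢0
  Δ≢0⇒∃≢0 P (x ∷ xs) f (P-x ∷ P-xs) PH Δ≢0
    with H′ , PH′ , δ≢0 ← Δ≢0⇒∃≢0 P xs (δ x f) P-xs PH Δ≢0
       | f (H′ [ x ]≔ true) ℤ.≟ 0ℤ
  ... | no  f₁≢0 = _ , P-x true PH′ , f₁≢0
  ... | yes f₁≡0 = _ , P-x false PH′ , λ f₀≡0 → δ≢0 (cong₂ _-_ f₁≡0 f₀≡0)

module _ {A : Set} where

  -- Laplace expansion along the column x; done holds the rows already passed over.
  perm : List (A → ℕ) → List A → ℕ
  expandAlong : A → List A → List (A → ℕ) → List (A → ℕ) → ℕ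
  perm rows []       = 1
  perm rows (x ∷ xs) = expandAlong x xs [] rows
  expandAlong x xs done []       = 0
  expandAlong x xs done (r ∷ rs) =
    r x ℕ.* perm (done ++ rs) xs ℕ.+ expandAlong x xs (done ++ [ r ]) rs

  perm-pos : ∀ {rows xs} → Pointwise (λ r x → 0 ℕ.< r x) rows xs → 0 ℕ.< perm rows xs
  perm-pos []              = s≤s z≤n
  perm-pos (r[x]>0 ∷ diag) = ℕP.≤-trans (ℕP.*-mono-≤ r[x]>0 (perm-pos diag)) (ℕP.m≤m+n _ _)

module _ {m : ℕ} where

  record Affine (xs : List (Fin m)) : Set where
    field
      fun        : Vec Bool m → ℤ
      slope      : Fin m → ℕ
      fun-update : ∀ H {x} → x ∈ xs → fun (H [ x ]≔ true) ≡ fun (H [ x ]≔ false) + + slope x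

  open Affine public

  restrict : ∀ {x xs} → x ∉ xs → Bool → Affine (x ∷ xs) → Affine xs
  restrict {x} {xs} x∉xs b r = record
    { fun        = λ H → fun r (H [ x ]≔ b)
    ; slope      = slope r
    ; fun-update = λ H {y} y∈xs →
        let y≢x = λ y≡x → x∉xs (subst (_∈ xs) y≡x y∈xs) in
        begin
          fun r ((H [ y ]≔ true) [ x ]≔ b)        ≡⟨ cong (fun r) ([]≔-commutes H y x y≢x) ⟩
          fun r ((H [ x ]≔ b) [ y ]≔ true)        ≡⟨ fun-update r (H [ x ]≔ b) (there y∈xs) ⟩
          fun r ((H [ x ]≔ b) [ y ]≔ false) + _   ≡⟨ cong (λ H′ → fun r H′ + _) ([]≔-commutes H x y (y≢x ∘ sym)) ⟩
          fun r ((H [ y ]≔ false) [ x ]≔ b) + _   ∎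
    }
    where open ≡-Reasoning

  prod : ∀ {xs} → List (Affine xs) → Vec Bool m → ℤ
  prod []       H = 1ℤ
  prod (r ∷ rs) H = fun r H * prod rs H

  prod-++ : ∀ {xs} (rs ss : List (Affine xs)) H → prod (rs ++ ss) H ≡ prod rs H * prod ss H
  prod-++ []       ss H = sym (ℤP.*-identityˡ _)
  prod-++ (r ∷ rs) ss H =
    trans (cong (fun r H *_) (prod-++ rs ss H)) (sym (ℤP.*-assoc (fun r H) (prod rs H) (prod ss H)))

  prod-restrict : ∀ {x xs} (x∉xs : x ∉ xs) b (rs : List (Affine (x ∷ xs))) H →
                  prod (map (restrict x∉xs b) rs) H ≡ prod rs (H [ x ]≔ b)
  prod-restrict x∉xs b []       H = refl
  prod-restrict x∉xs b (r ∷ rs) H = cong (fun r _ *_) (prod-restrict x∉xs b rs H)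

  slope-restrict : ∀ {x xs} (x∉xs : x ∉ xs) b (rs : List (Affine (x ∷ xs))) →
                   map slope (map (restrict x∉xs b) rs) ≡ map slope rs
  slope-restrict x∉xs b []       = refl
  slope-restrict x∉xs b (r ∷ rs) = cong (slope r ∷_) (slope-restrict x∉xs b rs)

  prod≢0⇒All≢0 : ∀ {xs} (rs : List (Affine xs)) H → prod rs H ≢ 0ℤ → All (λ r → fun r H ≢ 0ℤ) rs
  prod≢0⇒All≢0 []       H _ = []
  prod≢0⇒All≢0 (r ∷ rs) H prod≢0 =
    (λ r≡0 → prod≢0 (cong (_* prod rs H) r≡0))
    ∷ prod≢0⇒All≢0 rs H (λ rs≡0 → prod≢0 (trans (cong (fun r H *_) rs≡0) (ℤP.*-zeroʳ (fun r H))))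

  -- The discrete product rule for δ x: factors before r are taken at x = 1, those after r at x = 0.
  telescope : ∀ {x xs} → x ∉ xs → List (Affine xs) → List (Affine (x ∷ xs)) → Vec Bool m → ℤ
  telescope x∉xs done []           H = 0ℤ
  telescope {x} x∉xs done (r ∷ rs) H =
    + slope r x * prod (done ++ map (restrict x∉xs false) rs) H
    + telescope x∉xs (done ++ [ restrict x∉xs true r ]) rs H

  prod-*-δ≡telescope : ∀ {x xs} (x∉xs : x ∉ xs) done rows H →
                        prod done H * δ x (prod rows) H ≡ telescope x∉xs done rows H
  prod-*-δ≡telescope x∉xs done []           H = ℤP.*-zeroʳ (prod done H)
  prod-*-δ≡telescope {x} x∉xs done (r ∷ rs) H = begin
      P * (r₁ * Q₁ - r₀ * Q₀)
    ≡⟨ cong (λ z → P * (z * Q₁ - r₀ * Q₀)) (fun-update r H (here refl)) ⟩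
      P * ((r₀ + a) * Q₁ - r₀ * Q₀)
    ≡⟨ product-rule P r₀ a Q₁ Q₀ ⟩
      a * (P * Q₀) + P * ((r₀ + a) * 1ℤ) * (Q₁ - Q₀)
    ≡⟨ cong₂ (λ u v → a * u + v * (Q₁ - Q₀)) (sym prod-done-rs₀) (sym prod-done-r₁) ⟩
      a * prod (done ++ map (restrict x∉xs false) rs) H + prod done′ H * δ x (prod rs) H
    ≡⟨ cong (_+_ (a * _)) (prod-*-δ≡telescope x∉xs done′ rs H) ⟩
      telescope x∉xs done (r ∷ rs) H
    ∎
    where
    open ≡-Reasoning
    P  = prod done H
    a  = + slope r x
    r₁ = fun r (H [ x ]≔ true)
    r₀ = fun r (H [ x ]≔ false)
    Q₁ = prod rs (H [ x ]≔ true)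
    Q₀ = prod rs (H [ x ]≔ false)
    done′ = done ++ [ restrict x∉xs true r ]
    product-rule : ∀ P r₀ a Q₁ Q₀ → P * ((r₀ + a) * Q₁ - r₀ * Q₀) ≡ a * (P * Q₀) + P * ((r₀ + a) * 1ℤ) * (Q₁ - Q₀)
    product-rule = solve-∀
    prod-done-rs₀ : prod (done ++ map (restrict x∉xs false) rs) H ≡ P * Q₀
    prod-done-rs₀ = trans (prod-++ done _ H) (cong (P *_) (prod-restrict x∉xs false rs H))
    prod-done-r₁ : prod done′ H ≡ P * ((r₀ + a) * 1ℤ)
    prod-done-r₁ = trans (prod-++ done _ H) (cong (λ z → P * (z * 1ℤ)) (fun-update r H (here refl)))

  Δ-prod≡perm : ∀ xs → Unique xs → (rows : List (Affine xs)) → length rows ≡ length xs →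
                ∀ H → Δ xs (prod rows) H ≡ + perm (map slope rows) xs
  Δ-telescope≡expandAlong : ∀ {x xs} (x∉xs : x ∉ xs) → Unique xs →
    (done : List (Affine xs)) (rows : List (Affine (x ∷ xs))) →
    length done ℕ.+ length rows ≡ suc (length xs) → ∀ H →
    Δ xs (telescope x∉xs done rows) H ≡ + expandAlong x xs (map slope done) (map slope rows)

  Δ-prod≡perm []       _ []   _ H = refl
  Δ-prod≡perm (x ∷ xs) (x∉xs′ ∷ xs-unique) rows |rows| H =
    trans (Δ-cong xs (λ H → trans (sym (ℤP.*-identityˡ _)) (prod-*-δ≡telescope x∉xs [] rows H)) H)
          (Δ-telescope≡expandAlong x∉xs xs-unique [] rows |rows| H)
    where x∉xs = Unique.Unique[x∷xs]⇒x∉xs (x∉xs′ ∷ xs-unique)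

  Δ-telescope≡expandAlong {x} {xs} x∉xs xs-unique done []       _ H = Δ-0 xs H
  Δ-telescope≡expandAlong {x} {xs} x∉xs xs-unique done (r ∷ rs) |done|+|rows| H = begin
      Δ xs (λ H → a * prod minor H + telescope x∉xs done′ rs H) H
    ≡⟨ Δ-+ xs (λ H → a * prod minor H) (telescope x∉xs done′ rs) H ⟩
      Δ xs (λ H → a * prod minor H) H + Δ xs (telescope x∉xs done′ rs) H
    ≡⟨ cong₂ _+_ (trans (Δ-*ˡ xs a (prod minor) H) (cong (a *_) (Δ-prod≡perm xs xs-unique minor |minor| H)))
                 (Δ-telescope≡expandAlong x∉xs xs-unique done′ rs |done′|+|rs| H) ⟩
      a * + perm (map slope minor) xs + + expandAlong x xs (map slope done′) (map slope rs)
    ≡⟨ cong₂ (λ u v → a * + perm u xs + + expandAlong x xs v (map slope rs)) slopes-minor (map-++ slope done _) ⟩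
      a * + minor-perm + + rest
    ≡⟨ cong (_+ + rest) (sym (ℤP.pos-* (slope r x) minor-perm)) ⟩
      + (slope r x ℕ.* minor-perm) + + rest
    ≡⟨ sym (ℤP.pos-+ (slope r x ℕ.* minor-perm) rest) ⟩
      + expandAlong x xs (map slope done) (map slope (r ∷ rs))
    ∎
    where
    open ≡-Reasoning
    a = + slope r x
    minor = done ++ map (restrict x∉xs false) rs
    done′ = done ++ [ restrict x∉xs true r ]
    minor-perm = perm (map slope done ++ map slope rs) xs
    rest = expandAlong x xs (map slope done ++ [ slope r ]) (map slope rs)
    slopes-minor : map slope minor ≡ map slope done ++ map slope rs
    slopes-minor = trans (map-++ slope done _) (cong (map slope done ++_) (slope-restrict x∉xs false rs))
    |minor| : length minor ≡ length xs
    |minor| = ℕP.suc-injective (begin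
      suc (length minor)                                         ≡⟨ cong suc (length-++ done) ⟩
      suc (length done ℕ.+ length (map (restrict x∉xs false) rs)) ≡⟨ cong (λ k → suc (length done ℕ.+ k)) (length-map _ rs) ⟩
      suc (length done ℕ.+ length rs)                            ≡⟨ ℕP.+-suc (length done) (length rs) ⟨
      length done ℕ.+ length (r ∷ rs)                            ≡⟨ |done|+|rows| ⟩
      suc (length xs)                                            ∎)
    |done′|+|rs| : length done′ ℕ.+ length rs ≡ suc (length xs)
    |done′|+|rs| = begin
      length done′ ℕ.+ length rs                ≡⟨ cong (ℕ._+ length rs) (length-++ done) ⟩
      length done ℕ.+ 1 ℕ.+ length rs           ≡⟨ ℕP.+-assoc (length done) 1 (length rs) ⟩
      length done ℕ.+ length (r ∷ rs)           ≡⟨ |done|+|rows| ⟩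
      suc (length xs)                           ∎

  Δ-prod≢0 : ∀ {xs} → Unique xs → (rows : List (Affine xs)) →
             Pointwise (λ r x → 0 ℕ.< slope r x) rows xs → ∀ H → Δ xs (prod rows) H ≢ 0ℤ
  Δ-prod≢0 {xs} xs-unique rows diagonal H Δ≡0 =
    ℕP.n>0⇒n≢0 (perm-pos (subst (Pointwise _ (map slope rows)) (map-id xs) (Pointwise.map⁺ slope id diagonal)))
      (ℤP.+-injective (trans (sym (Δ-prod≡perm xs xs-unique rows (Pointwise-length diagonal) H)) Δ≡0))

  affine-product-nonvanishing :
    ∀ {xs} → Unique xs → (rows : List (Affine xs)) → Pointwise (λ r x → 0 ℕ.< slope r x) rows xs →
    (P : Vec Bool m → Set) → All (λ x → ∀ {H} b → P H → P (H [ x ]≔ b)) xs → ∀ {H} → P H →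
    ∃[ H′ ] P H′ × All (λ r → fun r H′ ≢ 0ℤ) rows
  affine-product-nonvanishing {xs} xs-unique rows diagonal P P-closed {H} PH
    with H′ , PH′ , prod≢0 ← Δ≢0⇒∃≢0 P xs (prod rows) P-closed PH (Δ-prod≢0 xs-unique rows diagonal H)
    = H′ , PH′ , prod≢0⇒All≢0 rows H′ prod≢0

-- Degrees

module _ (G : Digraph) where

  arcCount : EdgeSet G → (Fin (m G) → Bool) → ℕ
  arcCount S c = sum (map (λ e → indicator (S e ∧ c e)) (allFin (m G)))

  arcCount-update : ∀ {S S′ : EdgeSet G} {x} c → S x ≡ false → S′ x ≡ true → (∀ {y} → y ≢ x → S′ y ≡ S y) →
                    arcCount S′ c ≡ arcCount S c ℕ.+ indicator (c x)
  arcCount-update {S} {S′} {x} c Sx≡false S′x≡true S′≡S-off-x = begin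
      arcCount S′ c                              ≡⟨ ℕP.+-identityʳ _ ⟨
      arcCount S′ c ℕ.+ indicator (false ∧ c x)  ≡⟨ cong (λ b → arcCount S′ c ℕ.+ indicator (b ∧ c x)) Sx≡false ⟨
      arcCount S′ c ℕ.+ indicator (S x ∧ c x)    ≡⟨ sum-map-update (Unique.allFin⁺ (m G)) (∈-allFin x) summands-off-x ⟩
      arcCount S c ℕ.+ indicator (S′ x ∧ c x)    ≡⟨ cong (λ b → arcCount S c ℕ.+ indicator (b ∧ c x)) S′x≡true ⟩
      arcCount S c ℕ.+ indicator (c x)           ∎
    where
    open ≡-Reasoning
    summands-off-x : ∀ {y} → y ≢ x → indicator (S′ y ∧ c y) ≡ indicator (S y ∧ c y)
    summands-off-x {y} y≢x = cong (λ b → indicator (b ∧ c y)) (S′≡S-off-x y≢x)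

  arcCount-mono : ∀ {S S′ : EdgeSet G} c → (∀ e → S e ≡ true → S′ e ≡ true) → arcCount S c ℕ.≤ arcCount S′ c
  arcCount-mono c S⊆S′ = sum-map-mono (λ e → indicator-∧-mono (c e) (S⊆S′ e)) (allFin (m G))

  arcCount-disjoint : ∀ {S S′ : EdgeSet G} c → (∀ e → S e ≡ true → S′ e ≡ false) →
                      arcCount S c ℕ.+ arcCount S′ c ℕ.≤ arcCount (allEdges G) c
  arcCount-disjoint c S∩S′≡∅ =
    ℕP.≤-trans (ℕP.≤-reflexive (sym (sum-map-+ _ _ (allFin (m G)))))
               (sum-map-mono (λ e → indicator-∧-disjoint (c e) (S∩S′≡∅ e)) (allFin (m G)))

  incidence : Fin (n G) → Fin (m G) → ℕ
  incidence v e = indicator ⌊ tail G e ≟ v ⌋ ℕ.+ indicator ⌊ head G e ≟ v ⌋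

  deg-[]≔ : ∀ (H : Vec Bool (m G)) x v →
            deg G (lookup (H [ x ]≔ true)) v ≡ deg G (lookup (H [ x ]≔ false)) v ℕ.+ incidence v x
  deg-[]≔ H x v =
    trans (cong₂ ℕ._+_ (arcCount-update (λ e → ⌊ tail G e ≟ v ⌋) H₀[x] H₁[x] H₁≡H₀)
                       (arcCount-update (λ e → ⌊ head G e ≟ v ⌋) H₀[x] H₁[x] H₁≡H₀))
          (interchange (outdeg G H₀ v) (indicator ⌊ tail G x ≟ v ⌋) (indeg G H₀ v) (indicator ⌊ head G x ≟ v ⌋))
    where
    H₀ = lookup (H [ x ]≔ false)
    H₀[x] = lookup∘update x H false
    H₁[x] = lookup∘update x H true
    H₁≡H₀ : ∀ {y} → y ≢ x → lookup (H [ x ]≔ true) y ≡ H₀ y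
    H₁≡H₀ y≢x = trans (lookup∘update′ y≢x H true) (sym (lookup∘update′ y≢x H false))

  deg-mono : ∀ {S S′ : EdgeSet G} v → (∀ e → S e ≡ true → S′ e ≡ true) → deg G S v ℕ.≤ deg G S′ v
  deg-mono v S⊆S′ =
    ℕP.+-mono-≤ (arcCount-mono (λ e → ⌊ tail G e ≟ v ⌋) S⊆S′) (arcCount-mono (λ e → ⌊ head G e ≟ v ⌋) S⊆S′)

  deg-disjoint : ∀ {S S′ : EdgeSet G} v → (∀ e → S e ≡ true → S′ e ≡ false) →
                 deg G S v ℕ.+ deg G S′ v ℕ.≤ deg G (allEdges G) v
  deg-disjoint {S} {S′} v S∩S′≡∅ =
    ℕP.≤-trans (ℕP.≤-reflexive (interchange (outdeg G S v) (indeg G S v) (outdeg G S′ v) (indeg G S′ v)))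
               (ℕP.+-mono-≤ (arcCount-disjoint (λ e → ⌊ tail G e ≟ v ⌋) S∩S′≡∅)
                            (arcCount-disjoint (λ e → ⌊ head G e ≟ v ⌋) S∩S′≡∅))

  incidence-head>0 : ∀ {v e} → head G e ≡ v → 0 ℕ.< incidence v e
  incidence-head>0 {v} {e} head≡v with head G e ≟ v
  ... | yes _       = ℕP.m≤n+m 1 _
  ... | no  head≢v = ⊥-elim (head≢v head≡v)

  degreeMinus : ∀ {xs} → Fin (n G) → ℤ → Affine xs
  degreeMinus v b = record
    { fun        = λ H → + deg G (lookup H) v - b
    ; slope      = incidence v
    ; fun-update = λ H {x} _ →
        let d₀ = deg G (lookup (H [ x ]≔ false)) v in begin
        + deg G (lookup (H [ x ]≔ true)) v - b   ≡⟨ cong (λ d → + d - b) (deg-[]≔ H x v) ⟩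
        + (d₀ ℕ.+ incidence v x) - b             ≡⟨ cong (_- b) (ℤP.pos-+ d₀ (incidence v x)) ⟩
        + d₀ + + incidence v x - b               ≡⟨ swap-− (+ d₀) (+ incidence v x) b ⟩
        + d₀ - b + + incidence v x               ∎
    }
    where
    open ≡-Reasoning
    swap-− : ∀ a c b → a + c - b ≡ a - b + c
    swap-− = solve-∀

-- The factor H

module FreeEdges (G : Digraph) (F F₀ : EdgeSet G) (disj : ∀ e → F e ≡ true → F₀ e ≡ false) where

  FreeInto : Fin (n G) → Fin (m G) → Set
  FreeInto v e = F e ≡ false × F₀ e ≡ false × head G e ≡ v

  freeInto? : ∀ v e → Dec (FreeInto v e)
  freeInto? v e = (F e Bool.≟ false) ×-dec (F₀ e Bool.≟ false) ×-dec (head G e ≟ v)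

  freeInto : Fin (n G) → List (Fin (m G))
  freeInto v = filter (freeInto? v) (allFin (m G))

  ∈-freeInto⁻ : ∀ {v e} → e ∈ freeInto v → FreeInto v e
  ∈-freeInto⁻ {v} e∈ = proj₂ (∈-filter⁻ (freeInto? v) {xs = allFin (m G)} e∈)

  ∈-freeInto⇒head : ∀ {v e} → e ∈ freeInto v → head G e ≡ v
  ∈-freeInto⇒head = proj₂ ∘ proj₂ ∘ ∈-freeInto⁻

  indicator-partition : ∀ v e →
    indicator ⌊ head G e ≟ v ⌋ ≡
    indicator (F e ∧ ⌊ head G e ≟ v ⌋) ℕ.+ indicator (F₀ e ∧ ⌊ head G e ≟ v ⌋) ℕ.+ indicator ⌊ freeInto? v e ⌋
  indicator-partition v e with F e in Fe | F₀ e in F₀e | head G e ≟ v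
  ... | true  | true  | _     with () ← trans (sym (disj e Fe)) F₀e
  ... | true  | false | yes _ = refl
  ... | true  | false | no  _ = refl
  ... | false | true  | yes _ = refl
  ... | false | true  | no  _ = refl
  ... | false | false | yes _ = refl
  ... | false | false | no  _ = refl

  indeg-partition : ∀ v → indeg G (allEdges G) v ≡ indeg G F v ℕ.+ indeg G F₀ v ℕ.+ length (freeInto v)
  indeg-partition v = begin
      sum (map (λ e → indicator ⌊ head G e ≟ v ⌋) es)
    ≡⟨ cong sum (map-cong (indicator-partition v) es) ⟩
      sum (map (λ e → inF e ℕ.+ inF₀ e ℕ.+ inFree e) es)
    ≡⟨ sum-map-+ (λ e → inF e ℕ.+ inF₀ e) inFree es ⟩
      sum (map (λ e → inF e ℕ.+ inF₀ e) es) ℕ.+ sum (map inFree es)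
    ≡⟨ cong₂ ℕ._+_ (sum-map-+ inF inF₀ es) (sum-indicator≡length-filter (freeInto? v) es) ⟩
      indeg G F v ℕ.+ indeg G F₀ v ℕ.+ length (freeInto v)
    ∎
    where
    open ≡-Reasoning
    es = allFin (m G)
    inF inF₀ inFree : Fin (m G) → ℕ
    inF    e = indicator (F e ∧ ⌊ head G e ≟ v ⌋)
    inF₀   e = indicator (F₀ e ∧ ⌊ head G e ≟ v ⌋)
    inFree e = indicator ⌊ freeInto? v e ⌋

  vertices : List (Fin (n G))
  vertices = allFin (n G)

  freeEdges : List (Fin (m G))
  freeEdges = concat (map freeInto vertices)

  freeEdges-unique : Unique freeEdges
  freeEdges-unique =
    Unique.concat⁺ (All.map⁺ (All.universal (λ v → Unique.filter⁺ (freeInto? v) (Unique.allFin⁺ (m G))) vertices))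
                   (AllPairs.map⁺ (AllPairs.map heads-differ (Unique.allFin⁺ (n G))))
    where
    heads-differ : ∀ {v w} → v ≢ w → Disjoint (freeInto v) (freeInto w)
    heads-differ v≢w (e∈v , e∈w) = v≢w (trans (sym (∈-freeInto⇒head e∈v)) (∈-freeInto⇒head e∈w))

  Admissible : EdgeSet G → Set
  Admissible S = (∀ e → F e ≡ true → S e ≡ true) × (∀ e → F₀ e ≡ true → S e ≡ false)

  F₀⇒¬F : ∀ e → F₀ e ≡ true → F e ≡ false
  F₀⇒¬F e F₀e with F e in Fe
  ... | false = refl
  ... | true  with () ← trans (sym (disj e Fe)) F₀e

  admissible-F : Admissible F
  admissible-F = (λ _ Fe → Fe) , F₀⇒¬F

  admissible-tabulate-F : Admissible (lookup (tabulate F))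
  admissible-tabulate-F = (λ e Fe → trans (lookup∘tabulate F e) Fe)
                        , (λ e F₀e → trans (lookup∘tabulate F e) (F₀⇒¬F e F₀e))

  admissible-[]≔ : ∀ {e} → F e ≡ false → F₀ e ≡ false →
                   ∀ {H} b → Admissible (lookup H) → Admissible (lookup (H [ e ]≔ b))
  admissible-[]≔ {e} Fe F₀e {H} b (F⊆H , H∩F₀) =
      (λ y Fy → trans (lookup∘update′ (≢e Fy Fe) H b) (F⊆H y Fy))
    , (λ y F₀y → trans (lookup∘update′ (≢e F₀y F₀e) H b) (H∩F₀ y F₀y))
    where
    ≢e : ∀ {P : EdgeSet G} {y} → P y ≡ true → P e ≡ false → y ≢ e
    ≢e Py Pe refl with () ← trans (sym Py) Pe

  admissible-closed : All (λ e → ∀ {H} b → Admissible (lookup H) → Admissible (lookup (H [ e ]≔ b))) freeEdges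
  admissible-closed = All.concat⁺ (All.map⁺ (All.universal (λ v → All.tabulate (λ e∈ →
    let Fe , F₀e , _ = ∈-freeInto⁻ e∈ in λ {H} → admissible-[]≔ Fe F₀e {H})) vertices))

  admissible-deg-bounds : ∀ {S} → Admissible S → ∀ v →
                          deg G F v ℕ.≤ deg G S v × deg G S v ℕ.+ deg G F₀ v ℕ.≤ deg G (allEdges G) v
  admissible-deg-bounds {S} (F⊆S , S∩F₀) v = deg-mono G v F⊆S , deg-disjoint G v S⇒¬F₀
    where
    S⇒¬F₀ : ∀ e → S e ≡ true → F₀ e ≡ false
    S⇒¬F₀ e Se with F₀ e in F₀e
    ... | false = refl
    ... | true  with () ← trans (sym (S∩F₀ e F₀e)) Se

module ForbiddenDegrees
  (G : Digraph) (F F₀ : EdgeSet G) (disj : ∀ e → F e ≡ true → F₀ e ≡ false)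
  (s s₀ : Fin (n G) → ℤ) (s≤deg-F : ∀ v → s v ≤ + deg G F v) (s₀≤deg-F₀ : ∀ v → s₀ v ≤ + deg G F₀ v)
  (L : Fin (n G) → List ℤ) (L-unique : ∀ v → Unique (L v))
  (L-bounds : ∀ v → All (λ x → (s v ≤ x) × (x ≤ + deg G (allEdges G) v - s₀ v)) (L v))
  (L-large : ∀ v → + outdeg G (allEdges G) v + + 1 + + indeg G F v + + indeg G F₀ v - s v - s₀ v
                   ≤ + length (L v))
  where

  open FreeEdges G F F₀ disj

  upper : Fin (n G) → ℤ
  upper v = + deg G (allEdges G) v - s₀ v

  admissible-deg-range : ∀ {S} → Admissible S → ∀ v → s v ≤ + deg G S v × + deg G S v ≤ upper v
  admissible-deg-range {S} adm v = ℤP.≤-trans (s≤deg-F v) (ℤ.+≤+ F≤S) , S≤upper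
    where
    open ℤP.≤-Reasoning
    F≤S = proj₁ (admissible-deg-bounds adm v)
    S+F₀≤all = proj₂ (admissible-deg-bounds adm v)
    a+b-b : ∀ a b → a + b - b ≡ a
    a+b-b = solve-∀
    S≤upper : + deg G S v ≤ upper v
    S≤upper = begin
      + deg G S v                                  ≡⟨ a+b-b (+ deg G S v) (+ deg G F₀ v) ⟨
      + deg G S v + + deg G F₀ v - + deg G F₀ v    ≡⟨ cong (_- + deg G F₀ v) (ℤP.pos-+ (deg G S v) (deg G F₀ v)) ⟨
      + (deg G S v ℕ.+ deg G F₀ v) - + deg G F₀ v  ≤⟨ ℤP.+-monoˡ-≤ (- + deg G F₀ v) (ℤ.+≤+ S+F₀≤all) ⟩
      + deg G (allEdges G) v - + deg G F₀ v        ≤⟨ ℤP.+-monoʳ-≤ (+ deg G (allEdges G) v) (ℤP.neg-mono-≤ (s₀≤deg-F₀ v)) ⟩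
      upper v                                      ∎

  s≤upper : ∀ v → s v ≤ upper v
  s≤upper v = let s≤F , F≤upper = admissible-deg-range (admissible-F) v in ℤP.≤-trans s≤F F≤upper

  listBound : Fin (n G) → ℤ
  listBound v = + outdeg G (allEdges G) v + + 1 + + indeg G F v + + indeg G F₀ v - s v - s₀ v

  range-size : ∀ v → + suc ∣ upper v - s v ∣ ≡ + length (freeInto v) + listBound v
  range-size v = begin
    + suc ∣ upper v - s v ∣                    ≡⟨ ℤP.pos-+ 1 ∣ upper v - s v ∣ ⟩
    + 1 + + ∣ upper v - s v ∣                  ≡⟨ cong (_+_ (+ 1)) (ℤP.0≤i⇒+∣i∣≡i (ℤP.i≤j⇒0≤j-i (s≤upper v))) ⟩
    + 1 + (+ (out ℕ.+ inAll) - s₀ v - s v)     ≡⟨ cong (λ d → + 1 + (d - s₀ v - s v)) +deg≡ ⟩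
    + 1 + (+ out + (+ inF + + inF₀ + + nin) - s₀ v - s v)
                                               ≡⟨ rearrange (+ out) (+ inF) (+ inF₀) (+ nin) (s v) (s₀ v) ⟩
    + nin + (+ out + + 1 + + inF + + inF₀ - s v - s₀ v) ∎
    where
    open ≡-Reasoning
    out = outdeg G (allEdges G) v
    inAll = indeg G (allEdges G) v
    inF = indeg G F v
    inF₀ = indeg G F₀ v
    nin = length (freeInto v)
    +deg≡ : + (out ℕ.+ inAll) ≡ + out + (+ inF + + inF₀ + + nin)
    +deg≡ = begin
      + (out ℕ.+ inAll)                      ≡⟨ cong (λ i → + (out ℕ.+ i)) (indeg-partition v) ⟩
      + (out ℕ.+ (inF ℕ.+ inF₀ ℕ.+ nin))     ≡⟨ ℤP.pos-+ out _ ⟩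
      + out + + (inF ℕ.+ inF₀ ℕ.+ nin)       ≡⟨ cong (_+_ (+ out)) (ℤP.pos-+ (inF ℕ.+ inF₀) nin) ⟩
      + out + (+ (inF ℕ.+ inF₀) + + nin)     ≡⟨ cong (λ i → + out + (i + + nin)) (ℤP.pos-+ inF inF₀) ⟩
      + out + (+ inF + + inF₀ + + nin)       ∎
    rearrange : ∀ o a b c s s₀ → + 1 + (o + (a + b + c) - s₀ - s) ≡ c + (o + + 1 + a + b - s - s₀)
    rearrange = solve-∀

  gaps : Fin (n G) → List ℤ
  gaps v = missing (L v) (s v) (upper v)

  length-gaps≤ : ∀ v → length (gaps v) ℕ.≤ length (freeInto v)
  length-gaps≤ v = ℕP.+-cancelʳ-≤ (length (L v)) _ _ (ℤP.drop‿+≤+ (begin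
    + (length (gaps v) ℕ.+ length (L v))  ≤⟨ ℤ.+≤+ (length-missing (L-unique v) (L-bounds v)) ⟩
    + suc ∣ upper v - s v ∣               ≡⟨ range-size v ⟩
    + length (freeInto v) + listBound v    ≤⟨ ℤP.+-monoʳ-≤ (+ length (freeInto v)) (L-large v) ⟩
    + length (freeInto v) + + length (L v) ≡⟨ ℤP.pos-+ (length (freeInto v)) (length (L v)) ⟨
    + (length (freeInto v) ℕ.+ length (L v)) ∎))
    where open ℤP.≤-Reasoning

  -- Padded with arbitrary values to one value per free edge into v, so that the slope matrix is square.
  forbidden : Fin (n G) → List ℤ
  forbidden v = gaps v ++ replicate (length (freeInto v) ∸ length (gaps v)) 0ℤ

  length-forbidden : ∀ v → length (forbidden v) ≡ length (freeInto v)
  length-forbidden v = begin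
    length (forbidden v)                                        ≡⟨ length-++ (gaps v) ⟩
    length (gaps v) ℕ.+ length (replicate padding 0ℤ)           ≡⟨ cong (length (gaps v) ℕ.+_) (length-replicate padding) ⟩
    length (gaps v) ℕ.+ (length (freeInto v) ∸ length (gaps v)) ≡⟨ ℕP.m+[n∸m]≡n (length-gaps≤ v) ⟩
    length (freeInto v)                                         ∎
    where
    open ≡-Reasoning
    padding = length (freeInto v) ∸ length (gaps v)

  block : Fin (n G) → List (Affine freeEdges)
  block v = map (degreeMinus G v) (forbidden v)

  factors : List (Affine freeEdges)
  factors = concat (map block vertices)

  block-diagonal : ∀ {v} → Pointwise (λ r e → 0 ℕ.< slope r e) (block v) (freeInto v)
  block-diagonal {v} = subst (Pointwise _ (block v)) (map-id (freeInto v))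
    (Pointwise.map⁺ (degreeMinus G v) id (Pointwise.lookup⁻ (length-forbidden v)
      (λ {_} {j} _ → incidence-head>0 G (∈-freeInto⇒head (∈-lookup j)))))

  factors-diagonal : Pointwise (λ r e → 0 ℕ.< slope r e) factors freeEdges
  factors-diagonal = Pointwise.concat⁺ (Pointwise.map⁺ block freeInto (Pointwise.refl block-diagonal {vertices}))

  deg∈L : ∀ {H} → Admissible (lookup H) → All (λ r → fun r H ≢ 0ℤ) factors → ∀ v → + deg G (lookup H) v ∈ L v
  deg∈L {H} adm factors≢0 v with + deg G (lookup H) v ∈? L v
  ... | yes d∈L = d∈L
  ... | no  d∉L = ⊥-elim (All.lookup factors≢0 d-factor∈ (ℤP.+-inverseʳ d))
    where
    d = + deg G (lookup H) v
    d-range = admissible-deg-range adm v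
    d-factor∈ : degreeMinus G v d ∈ factors
    d-factor∈ = ∈-concat⁺′ (∈-map⁺ (degreeMinus G v) (∈-++⁺ˡ (∈-missing (proj₁ d-range) (proj₂ d-range) d∉L)))
                           (∈-map⁺ block (∈-allFin v))

corollary3p2 : (G : Digraph) (F F₀ : EdgeSet G)
    → (∀ e → F e ≡ true → F₀ e ≡ false)
    → (s s₀ : Fin (n G) → ℤ)
    → (∀ v → s v ≤ + deg G F v)
    → (∀ v → s₀ v ≤ + deg G F₀ v)
    → (L : Fin (n G) → List ℤ)
    → (∀ v → Unique (L v))
    → (∀ v → All (λ x → (s v ≤ x) × (x ≤ + deg G (allEdges G) v - s₀ v)) (L v))
    → (∀ v → + outdeg G (allEdges G) v + + 1 + + indeg G F v + + indeg G F₀ v - s v - s₀ v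
    ≤ + length (L v))
    → Σ (EdgeSet G) (λ H →
    (∀ e → F e ≡ true → H e ≡ true)
    × (∀ e → F₀ e ≡ true → H e ≡ false)
    × (∀ v → + deg G H v ∈ L v))
corollary3p2 G F F₀ disj s s₀ s≤deg-F s₀≤deg-F₀ L L-unique L-bounds L-large =
  let H , H-admissible , factors≢0 =
        affine-product-nonvanishing freeEdges-unique factors factors-diagonal
          (Admissible ∘ lookup) admissible-closed {tabulate F} admissible-tabulate-F
  in lookup H , proj₁ H-admissible , proj₂ H-admissible , deg∈L H-admissible factors≢0
  where
  open FreeEdges G F F₀ disj
  open ForbiddenDegrees G F F₀ disj s s₀ s≤deg-F s₀≤deg-F₀ L L-unique L-bounds L-large
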